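{- Let $\Pi=(V,W)$ be a presentation on a set $E$ which is stellar with respect to a set $\mathcal F$ of pairwise disjoint subsets of $E$. Let $F_0\in\mathcal F$ and $w_0\in k^{F_0}$, and let $Q\subseteq E$ be disjoint from every member of $\mathcal F$. For each $F\in\mathcal F\setminus\{F_0\}$ let $W(F)$ be a subset of $k^F$. Suppose that for every $v\in V$ with $\sum_{e\in F_0}v(e)w_0(e)\neq0$ and $\mathrm{supp}(v)\cap Q=\emptyset$ there are $F\in\mathcal F\setminus\{F_0\}$ and $w\in W(F)$ with $\sum_{e\in F}v(e)w(e)\neq 0$. Then there is $w\in W$ such that $w\restriction_{F_0}=w_0$, $\mathrm{supp}(w)\subseteq Q\cup\bigcup\mathcal F$, and $w\restriction_F\in\langle W(F)\rangle$ (the linear span of $W(F)$) for each $F\in\mathcal F\setminus\{F_0\}$.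
   Context: Fix a field $k$. For $v\in k^E$, $\mathrm{supp}(v)=\{e:v(e)\neq0\}$; vectors are identified with their restriction to their support. $v\perp w$ means $\sum_e v(e)w(e)$ has only finitely many nonzero terms and equals $0$. $S(V)$ is the set of supports. A presentation on $E$ is a pair $(V,W)$ of orthogonal subspaces of $k^E$ such that for every partition $E=P\,\dot\cup\,Q\,\dot\cup\,\{e\}$ there is $v\in V$ with $e\in\mathrm{supp}(v)\subseteq P\cup\{e\}$ or $w\in W$ with $e\in\mathrm{supp}(w)\subseteq Q\cup\{e\}$. It presents a matroid $M$ (infinite matroids in the sense of Bruhn et al.) if the circuits of $M$ are the minimal nonempty elements of $S(V)$ and the cocircuits the minimal nonempty elements of $S(W)$. A tree of presentations $(T,\overline V,\overline W)$: a tree $T$ with a presentation $(\overline V(t),\overline W(t))$ on a set $E(t)$ at each node, with $E(t)\cap E(t')$ finite for $t\neq t'$ and empty unless $tt'\in E(T)$; $E(tt')=E(t)\cap E(t')$; ground set $\bigcup_tE(t)\setminus\bigcup_{tt'}E(tt')$. A pre-vector $(S,\overline v)$: $S$ a subtree, $\overline v(t)\in\overline V(t)$ for $t\in S$, with $\overline v(t)\restriction_{E(tu)}=\overline v(u)\restriction_{E(tu)}\neq 0$ for adjacent $t,u\in S$ and $\overline v(t)\restriction_{E(tu)}=0$ for $t\in S$, $u\notin S$ adjacent; underlying vector takes value $\overline v(t)(e)$ at ground-set elements $e\in E(t)$, $t\in S$, and $0$ elsewhere. Pre-covectors are the same with $\overline w(t)\in\overline W(t)$ and $\overline w(t)\restriction_{E(tu)}=-\overline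 w(u)\restriction_{E(tu)}\neq0$. For a rayless $T$, $\Pi_\emptyset$ is the pair (span of underlying vectors of pre-vectors, span of underlying covectors of pre-covectors). An $\mathcal F$-star around $\Pi$ is a tree of presentations whose tree is a star with centre $*$ and leaf set $\mathcal F$, with presentation $\Pi$ at $*$, and with each leaf $F$ having a finite ground set $E(F)$ with $E(*)\cap E(F)=F$. $\Pi$ is stellar with respect to $\mathcal F$ if for every $\mathcal F$-star $\mathcal S$ around $\Pi$, $\Pi_\emptyset(\mathcal S)$ is a presentation and presents a matroid. -}

module Defs where

open import Level using (Level; 0ℓ; _⊔_) renaming (suc to lsuc)
open import Algebra.Bundles using (CommutativeRing)
open import Data.Product using (Σ; ∃; ∃-syntax; _×_; _,_; proj₁; proj₂)
open import Data.Sum using (_⊎_; inj₁; inj₂)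
open import Data.List using (List; []; _∷_; foldr; map)
open import Data.List.Membership.Propositional using (_∈_)
open import Data.List.Relation.Unary.All using (All)
open import Data.List.Relation.Unary.Unique.Propositional using (Unique)
open import Data.Unit using (⊤)
open import Data.Empty using (⊥)
open import Data.Fin using (Fin)
open import Data.Nat using (ℕ)
open import Relation.Nullary using (¬_)
open import Relation.Binary.PropositionalEquality using (_≡_; _≢_)
open import Relation.Unary using (Pred; _⊆_; ∅; _∪_; ｛_｝)

record Field : Set₁ where
  field
    commRing : CommutativeRing 0ℓ 0ℓ
  open CommutativeRing commRing public
  field
    0≉1     : ¬ (0# ≈ 1#)
    inverse : ∀ x → ¬ (x ≈ 0#) → ∃[ y ] (x * y ≈ 1#)

Finite : {A : Set} → Pred A 0ℓ → Set
Finite {A} X = ∃[ xs ] (∀ (a : A) → X a → a ∈ xs)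

Maximal : {A : Set} {ℓ : Level} → (Pred A 0ℓ → Set ℓ) → Pred A 0ℓ → Set (lsuc 0ℓ ⊔ ℓ)
Maximal 𝒮 X = 𝒮 X × (∀ Y → 𝒮 Y → X ⊆ Y → Y ⊆ X)

Minimal : {A : Set} {ℓ : Level} → (Pred A 0ℓ → Set ℓ) → Pred A 0ℓ → Set (lsuc 0ℓ ⊔ ℓ)
Minimal 𝒮 X = 𝒮 X × (∀ Y → 𝒮 Y → Y ⊆ X → X ⊆ Y)

Nonempty : {A : Set} → Pred A 0ℓ → Set
Nonempty {A} X = Σ A X

-- Matroids in the sense of Bruhn, Diestel, Kriesell, Pendavingh, Wollan,
-- given by their independent sets, on a ground set G ⊆ U.

record IsMatroid {U : Set} (G : Pred U 0ℓ) (I : Pred U 0ℓ → Set) : Set₁ where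
  field
    ground : ∀ X → I X → X ⊆ G
    I1     : I ∅
    I2     : ∀ X Y → I Y → X ⊆ Y → I X
    I3     : ∀ X Y → I X → ¬ Maximal I X → Maximal I Y →
             ∃[ x ] (Y x × ¬ X x × I (X ∪ ｛ x ｝))
    IM     : ∀ X Y → I X → X ⊆ Y → Y ⊆ G →
             ∃[ Z ] Maximal {ℓ = 0ℓ} (λ Z → I Z × X ⊆ Z × Z ⊆ Y) Z

module _ {U : Set} (G : Pred U 0ℓ) (I : Pred U 0ℓ → Set) where

  Base : Pred U 0ℓ → Set₁
  Base = Maximal I

  DualIndep : Pred U 0ℓ → Set₁
  DualIndep X = X ⊆ G × ∃[ B ] (Base B × (∀ x → X x → ¬ B x))

  Circuit : Pred U 0ℓ → Set₁
  Circuit = Minimal (λ X → X ⊆ G × ¬ I X)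

  Cocircuit : Pred U 0ℓ → Set₁
  Cocircuit = Minimal (λ X → X ⊆ G × ¬ DualIndep X)

module _ (K : Field) where
  open Field K

  KVec : Set → Set
  KVec U = U → Carrier

  supp : {U : Set} → KVec U → Pred U 0ℓ
  supp v e = ¬ (v e ≈ 0#)

  sumL : List Carrier → Carrier
  sumL = foldr _+_ 0#

  -- "∑_{e ∈ A} f(e) has only finitely many nonzero terms and equals s"
  SumOver : {U : Set} → Pred U 0ℓ → (U → Carrier) → Carrier → Set
  SumOver A f s =
    ∃[ xs ] (Unique xs × All A xs × (∀ e → A e → ¬ (f e ≈ 0#) → e ∈ xs)
             × sumL (map f xs) ≈ s)

  Orth : {U : Set} → KVec U → KVec U → Set
  Orth v w = SumOver (λ _ → ⊤) (λ e → v e * w e) 0#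

  lincomb : {U : Set} → List (Carrier × KVec U) → KVec U
  lincomb xs x = foldr (λ p acc → proj₁ p * proj₂ p x + acc) 0# xs

  InSpanOn : {U : Set} {ℓ : Level} → Pred U 0ℓ → Pred (KVec U) ℓ → KVec U → Set ℓ
  InSpanOn A P u =
    ∃[ xs ] (All (λ p → P (proj₂ p)) xs × (∀ x → A x → u x ≈ lincomb xs x))

  InSpan : {U : Set} {ℓ : Level} → Pred (KVec U) ℓ → KVec U → Set ℓ
  InSpan = InSpanOn (λ _ → ⊤)

  -- a subspace of k^G, G ⊆ U (vectors in k^G are the vectors of k^U
  -- vanishing outside G)
  record IsSubspace {U : Set} {ℓ : Level} (G : Pred U 0ℓ) (V : Pred (KVec U) ℓ) : Set ℓ where
    field
      supported : ∀ {v} → V v → supp v ⊆ G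
      resp      : ∀ {u v} → (∀ e → u e ≈ v e) → V u → V v
      hasZero   : V (λ _ → 0#)
      add       : ∀ {u v} → V u → V v → V (λ e → u e + v e)
      scale     : ∀ c {v} → V v → V (λ e → c * v e)

  record IsPresentation {U : Set} {ℓ : Level} (G : Pred U 0ℓ)
           (V W : Pred (KVec U) ℓ) : Set (lsuc 0ℓ ⊔ ℓ) where
    field
      subV  : IsSubspace G V
      subW  : IsSubspace G W
      orth  : ∀ v w → V v → W w → Orth v w
      -- partition G = P ∪̇ Q ∪̇ {e} with Q = G ∖ (P ∪ {e})
      split : ∀ (P : Pred U 0ℓ) e → P ⊆ G → G e → ¬ P e →
              (∃[ v ] (V v × supp v e × (∀ x → supp v x → P x ⊎ x ≡ e)))
              ⊎ (∃[ w ] (W w × supp w e × (∀ x → supp w x → (G x × ¬ P x) ⊎ x ≡ e)))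

  IsSupp : {U : Set} {ℓ : Level} → Pred (KVec U) ℓ → Pred U 0ℓ → Set ℓ
  IsSupp V C = ∃[ v ] (V v × supp v ⊆ C × C ⊆ supp v)

  MinSupp : {U : Set} {ℓ : Level} → Pred (KVec U) ℓ → Pred U 0ℓ → Set (lsuc 0ℓ ⊔ ℓ)
  MinSupp V = Minimal (λ X → IsSupp V X × Nonempty X)

  PresentsMatroid : {U : Set} {ℓ : Level} (G : Pred U 0ℓ) → Pred (KVec U) ℓ → Pred (KVec U) ℓ → Set (lsuc 0ℓ ⊔ ℓ)
  PresentsMatroid {U} G V W =
    ∃[ I ] (IsMatroid G I
      × (∀ (C : Pred U 0ℓ) → (Circuit G I C → MinSupp V C) × (MinSupp V C → Circuit G I C))
      × (∀ (C : Pred U 0ℓ) → (Cocircuit G I C → MinSupp W C) × (MinSupp W C → Cocircuit G I C)))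

  -- The leaf F has ground
  -- set E(F) = F ∪̇ X_F with X_F a finite set of new elements (X_F = Fin (m F)),
  -- modelled inside the type E ⊎ Fin (m F).

  LeafG : {E ι : Set} (F : ι → Pred E 0ℓ) (m : ι → ℕ) (i : ι) → Pred (E ⊎ Fin (m i)) 0ℓ
  LeafG F m i (inj₁ e) = F i e
  LeafG F m i (inj₂ _) = ⊤

  record Star {E ι : Set} (F : ι → Pred E 0ℓ) : Set₁ where
    field
      m       : ι → ℕ
      Ffinite : ∀ i → Finite (F i)
      Vl Wl   : (i : ι) → Pred (KVec (E ⊎ Fin (m i))) 0ℓ
      pres    : ∀ i → IsPresentation (LeafG F m i) (Vl i) (Wl i)

  module _ {E ι : Set} {F : ι → Pred E 0ℓ} (𝒮 : Star F) where
    open Star 𝒮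

    -- ground set of the star: (E ∖ ⋃𝓕) ∪̇ ⋃_F X_F
    StarU : Set
    StarU = E ⊎ Σ ι (λ i → Fin (m i))

    StarG : Pred StarU 0ℓ
    StarG (inj₁ e) = ¬ (∃[ i ] F i e)
    StarG (inj₂ _) = ⊤

  data Node (ι : Set) : Set where
    centre : Node ι
    leaf   : ι → Node ι

  -- nonempty connected subsets of the star
  IsSubtree : {ι : Set} → Pred (Node ι) 0ℓ → Set
  IsSubtree {ι} S = Nonempty S × (∀ (i j : ι) → S (leaf i) → S (leaf j) → i ≢ j → S centre)

  module _ {E ι : Set} {F : ι → Pred E 0ℓ} (𝒮 : Star F) where
    open Star 𝒮

    -- pre-vectors (sgn = id) and pre-covectors (sgn = -_) with subtree S
    -- and node values vc (centre), vl i (leaf i)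
    record IsPre (sgn : Carrier → Carrier) (VC : Pred (KVec E) 0ℓ)
                 (VL : (i : ι) → Pred (KVec (E ⊎ Fin (m i))) 0ℓ)
                 (S : Pred (Node ι) 0ℓ) (vc : KVec E)
                 (vl : (i : ι) → KVec (E ⊎ Fin (m i))) : Set where
      field
        nodeC : S centre → VC vc
        nodeL : ∀ i → S (leaf i) → VL i (vl i)
        adjEq : ∀ i → S centre → S (leaf i) → ∀ e → F i e → vc e ≈ sgn (vl i (inj₁ e))
        adjNz : ∀ i → S centre → S (leaf i) → ∃[ e ] (F i e × ¬ (vc e ≈ 0#))
        outL  : ∀ i → S centre → ¬ S (leaf i) → ∀ e → F i e → vc e ≈ 0#
        outC  : ∀ i → S (leaf i) → ¬ S centre → ∀ e → F i e → vl i (inj₁ e) ≈ 0#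

    record Underlies (S : Pred (Node ι) 0ℓ) (vc : KVec E)
                     (vl : (i : ι) → KVec (E ⊎ Fin (m i))) (u : KVec (StarU 𝒮)) : Set where
      field
        inC   : ∀ e → ¬ (∃[ i ] F i e) → S centre → u (inj₁ e) ≈ vc e
        outCu : ∀ e → ¬ (∃[ i ] F i e) → ¬ S centre → u (inj₁ e) ≈ 0#
        inF   : ∀ e → ∃[ i ] F i e → u (inj₁ e) ≈ 0#
        inLf  : ∀ i x → S (leaf i) → u (inj₂ (i , x)) ≈ vl i (inj₂ x)
        outLf : ∀ i x → ¬ S (leaf i) → u (inj₂ (i , x)) ≈ 0#

    UnderlyingOf : (Carrier → Carrier) → Pred (KVec E) 0ℓ →
                   ((i : ι) → Pred (KVec (E ⊎ Fin (m i))) 0ℓ) → Pred (KVec (StarU 𝒮)) (lsuc 0ℓ)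
    UnderlyingOf sgn VC VL u =
      ∃[ S ] ∃[ vc ] ∃[ vl ] (IsSubtree S × IsPre sgn VC VL S vc vl × Underlies S vc vl u)

    V∅ : Pred (KVec E) 0ℓ → Pred (KVec (StarU 𝒮)) (lsuc 0ℓ)
    V∅ V = InSpan (UnderlyingOf (λ x → x) V Vl)

    W∅ : Pred (KVec E) 0ℓ → Pred (KVec (StarU 𝒮)) (lsuc 0ℓ)
    W∅ W = InSpan (UnderlyingOf -_ W Wl)

  Stellar : {E ι : Set} → Pred (KVec E) 0ℓ → Pred (KVec E) 0ℓ → (ι → Pred E 0ℓ) → Set₁
  Stellar V W F = ∀ (𝒮 : Star F) →
    IsPresentation (StarG 𝒮) (V∅ 𝒮 V) (W∅ 𝒮 W) × PresentsMatroid (StarG 𝒮) (V∅ 𝒮 V) (W∅ 𝒮 W)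

module Submission where

-- One 𝓕-star suffices.  Glue to F₀ a leaf with a new element x₀ whose covector
-- space is spanned by (w₀, 1), and to every other F a leaf with a new element ⋆
-- whose vectors are the v ⊥ W(F) with v(⋆) = 0; on a finite leaf the covectors
-- V^⊥ are the span of the generators, by the finite Fredholm alternative.
-- Stellarity makes Π_∅ of this star a presentation, and its partition axiom at
-- x₀ with P = E ∖ (Q ∪ ⋃𝓕) yields a vector or a covector through x₀.  The centre
-- of such a vector is a v ∈ V with Σ_{F₀} v·w₀ = -v(x₀) ≠ 0, v↾Q = 0 and v ⊥ W(F)
-- for F ≠ F₀, which the hypothesis forbids.  The centre of such a covector is a
-- w ∈ W supported in Q ∪ ⋃𝓕 with w↾F₀ = -w(x₀)·w₀ and w↾F ∈ ⟨W(F)⟩; rescale.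

open import Defs
open import Level using (0ℓ; lift; lower) renaming (suc to lsuc)
open import Axiom.ExcludedMiddle using (ExcludedMiddle)
open import Data.Empty using (⊥; ⊥-elim)
open import Data.Fin using (Fin)
open import Data.List using (List; []; _∷_; _++_; map; filter; deduplicate)
open import Data.List.Membership.Propositional using (_∈_; _∉_)
open import Data.List.Membership.Propositional.Properties
  using (∈-filter⁺; ∈-filter⁻; ∈-deduplicate⁺; ∈-map⁺)
open import Data.List.Relation.Unary.All as All using (All; []; _∷_)
open import Data.List.Relation.Unary.All.Properties using (All¬⇒¬Any; ++⁺; map⁺)
open import Data.List.Relation.Unary.AllPairs using (_∷_)
open import Data.List.Relation.Unary.Any using (here; there)
open import Data.List.Relation.Unary.Unique.Propositional using (Unique)
import Data.List.Relation.Unary.Unique.Propositional.Properties as Unique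
import Data.List.Relation.Unary.Unique.DecPropositional.Properties as DecUnique
open import Data.Maybe using (nothing)
open import Data.Product using (∃-syntax; _×_; _,_; proj₁; proj₂)
open import Data.Sum as ⊎ using (_⊎_; inj₁; inj₂; [_,_]′)
open import Data.Unit using (⊤; tt)
open import Function using (_∘_; id)
open import Relation.Nullary using (¬_; Dec; yes; no)
open import Relation.Nullary.Decidable using (map′; decidable-stable)
import Relation.Binary.PropositionalEquality as ≡
open ≡ using (_≡_; _≢_)
open import Relation.Unary using (Pred; _⊆_)
open import Tactic.RingSolver.Core.AlmostCommutativeRing using (fromCommutativeRing)

module Classical (em : ExcludedMiddle (lsuc 0ℓ)) where

  dec : (A : Set) → Dec A
  dec A = map′ lower lift em

  stable : {A : Set} → ¬ ¬ A → A
  stable = decidable-stable (dec _)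

record Enumeration {A : Set} (X : Pred A 0ℓ) : Set where
  field
    list     : List A
    unique   : Unique list
    sound    : All X list
    complete : ∀ {a} → X a → a ∈ list

finite⇒enumeration : ExcludedMiddle (lsuc 0ℓ) → {A : Set} {X : Pred A 0ℓ} → Finite X → Enumeration X
finite⇒enumeration em {A} {X} (xs , cover) = record
  { list     = filter X? (deduplicate _≟_ xs)
  ; unique   = Unique.filter⁺ X? (DecUnique.deduplicate-! _≟_ xs)
  ; sound    = All.tabulate (proj₂ ∘ ∈-filter⁻ X? {xs = deduplicate _≟_ xs})
  ; complete = λ {a} Xa → ∈-filter⁺ X? (∈-deduplicate⁺ _≟_ (cover a Xa)) Xa
  }
  where
    open Classical em
    _≟_ : (a b : A) → Dec (a ≡ b)
    a ≟ b = dec (a ≡ b)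
    X? : (a : A) → Dec (X a)
    X? a = dec (X a)

enumeration-∖ : ExcludedMiddle (lsuc 0ℓ) → {A : Set} {X : Pred A 0ℓ} → Enumeration X →
                (P : Pred A 0ℓ) → Enumeration (λ a → X a × ¬ P a)
enumeration-∖ em X-enum P = record
  { list     = filter ¬P? list
  ; unique   = Unique.filter⁺ ¬P? unique
  ; sound    = All.tabulate λ a∈ → let a∈list , ¬Pa = ∈-filter⁻ ¬P? {xs = list} a∈ in All.lookup sound a∈list , ¬Pa
  ; complete = λ (Xa , ¬Pa) → ∈-filter⁺ ¬P? (complete Xa) ¬Pa
  }
  where
    open Enumeration X-enum
    ¬P? : ∀ a → Dec (¬ P a)
    ¬P? a = Classical.dec em (¬ P a)

module LinearAlgebra (K : Field) (em : ExcludedMiddle (lsuc 0ℓ)) where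
  open Field K
  open Classical em
  open import Algebra.Properties.Ring ring using (-‿distribˡ-*)
  open import Relation.Binary.Reasoning.Setoid setoid
  open import Tactic.RingSolver.NonReflective (fromCommutativeRing commRing (λ _ → nothing))

  private
    variable
      U : Set

  ∑ : List U → (U → Carrier) → Carrier
  ∑ L f = sumL K (map f L)

  ∑-cong : (L : List U) {f g : U → Carrier} → (∀ {y} → y ∈ L → f y ≈ g y) → ∑ L f ≈ ∑ L g
  ∑-cong []      f≈g = refl
  ∑-cong (x ∷ L) f≈g = +-cong (f≈g (here ≡.refl)) (∑-cong L (f≈g ∘ there))

  ∑-zero : (L : List U) {f : U → Carrier} → (∀ {y} → y ∈ L → f y ≈ 0#) → ∑ L f ≈ 0#
  ∑-zero []      f≈0 = refl
  ∑-zero (x ∷ L) f≈0 = trans (+-cong (f≈0 (here ≡.refl)) (∑-zero L (f≈0 ∘ there))) (+-identityˡ 0#)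

  ∑-+ : (L : List U) (f g : U → Carrier) → ∑ L (λ y → f y + g y) ≈ ∑ L f + ∑ L g
  ∑-+ []      f g = sym (+-identityˡ 0#)
  ∑-+ (x ∷ L) f g = trans (+-congˡ (∑-+ L f g))
    (solve 4 (λ a b s t → ((a ⊕ b) ⊕ (s ⊕ t)) ⊜ ((a ⊕ s) ⊕ (b ⊕ t))) refl (f x) (g x) (∑ L f) (∑ L g))

  ∑-* : (L : List U) (c : Carrier) (f : U → Carrier) → ∑ L (λ y → c * f y) ≈ c * ∑ L f
  ∑-* []      c f = sym (zeroʳ c)
  ∑-* (x ∷ L) c f = trans (+-congˡ (∑-* L c f)) (sym (distribˡ c (f x) (∑ L f)))

  ∑-swap : {V : Set} (L : List U) (M : List V) (f : U → V → Carrier) →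
           ∑ L (λ x → ∑ M (f x)) ≈ ∑ M (λ y → ∑ L (λ x → f x y))
  ∑-swap []      M f = sym (∑-zero M (λ _ → refl))
  ∑-swap (x ∷ L) M f = trans (+-congˡ (∑-swap L M f)) (sym (∑-+ M (f x) (λ y → ∑ L (λ x → f x y))))

  ∑-map : {V : Set} (L : List U) (g : U → V) (f : V → Carrier) → ∑ (map g L) f ≡ ∑ L (f ∘ g)
  ∑-map []      g f = ≡.refl
  ∑-map (x ∷ L) g f = ≡.cong (f (g x) +_) (∑-map L g f)

  dot : List U → (U → Carrier) → (U → Carrier) → Carrier
  dot L v w = ∑ L (λ y → v y * w y)

  dot-comm : (L : List U) (v w : U → Carrier) → dot L v w ≈ dot L w v
  dot-comm L v w = ∑-cong L (λ {y} _ → *-comm (v y) (w y))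

  dot-linearʳ : (L : List U) (v : U → Carrier) (c : Carrier) (s w : U → Carrier) →
                dot L v (λ y → c * s y + w y) ≈ c * dot L v s + dot L v w
  dot-linearʳ L v c s w = begin
    ∑ L (λ y → v y * (c * s y + w y))          ≈⟨ ∑-cong L (λ {y} _ → expand (v y) (s y) (w y)) ⟩
    ∑ L (λ y → c * (v y * s y) + v y * w y)    ≈⟨ ∑-+ L _ _ ⟩
    ∑ L (λ y → c * (v y * s y)) + dot L v w    ≈⟨ +-congʳ (∑-* L c _) ⟩
    c * dot L v s + dot L v w                  ∎
    where
      expand : ∀ a b d → a * (c * b + d) ≈ c * (a * b) + a * d
      expand = solve 4 (λ c a b d → (a ⊗ (c ⊗ b ⊕ d)) ⊜ (c ⊗ (a ⊗ b) ⊕ a ⊗ d)) refl c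

  δ : U → U → Carrier
  δ e y with dec (e ≡ y)
  ... | yes _ = 1#
  ... | no _  = 0#

  δ-refl : (e : U) → δ e e ≈ 1#
  δ-refl e with dec (e ≡ e)
  ... | yes _  = refl
  ... | no e≢e = ⊥-elim (e≢e ≡.refl)

  δ-≢ : {e y : U} → e ≢ y → δ e y ≈ 0#
  δ-≢ {e = e} {y} e≢y with dec (e ≡ y)
  ... | yes e≡y = ⊥-elim (e≢y e≡y)
  ... | no _    = refl

  δ-supp : {e y : U} → ¬ (δ e y ≈ 0#) → e ≡ y
  δ-supp {e = e} {y} δ≉0 with dec (e ≡ y)
  ... | yes e≡y = e≡y
  ... | no _    = ⊥-elim (δ≉0 refl)

  δ-swap : (f : U → Carrier) (x y : U) → δ x y * f y ≈ δ y x * f x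
  δ-swap f x y with dec (x ≡ y)
  ... | yes ≡.refl = *-congʳ (sym (δ-refl x))
  ... | no x≢y     = trans (zeroˡ _) (sym (trans (*-congʳ (δ-≢ (x≢y ∘ ≡.sym))) (zeroˡ _)))

  ∑-δ-∉ : (L : List U) {e : U} (f : U → Carrier) → e ∉ L → ∑ L (λ y → δ e y * f y) ≈ 0#
  ∑-δ-∉ L f e∉L = ∑-zero L (λ y∈L → trans (*-congʳ (δ-≢ (λ { ≡.refl → e∉L y∈L }))) (zeroˡ _))

  ∑-δ-∈ : (L : List U) {e : U} (f : U → Carrier) → Unique L → e ∈ L → ∑ L (λ y → δ e y * f y) ≈ f e
  ∑-δ-∈ (x ∷ L) f (x∉L ∷ _) (here ≡.refl) =
    trans (+-cong (trans (*-congʳ (δ-refl x)) (*-identityˡ _)) (∑-δ-∉ L f (All¬⇒¬Any x∉L))) (+-identityʳ _)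
  ∑-δ-∈ (x ∷ L) f (x∉L ∷ uniq) (there e∈L) =
    trans (+-cong (trans (*-congʳ (δ-≢ λ { ≡.refl → All¬⇒¬Any x∉L e∈L })) (zeroˡ _)) (∑-δ-∈ L f uniq e∈L))
          (+-identityˡ _)

  ∑-δ : (L : List U) {e : U} (f : U → Carrier) → Unique L → (¬ (f e ≈ 0#) → e ∈ L) →
        ∑ L (λ y → δ e y * f y) ≈ f e
  ∑-δ L {e} f uniq cover with dec (e ∈ L)
  ... | yes e∈L = ∑-δ-∈ L f uniq e∈L
  ... | no e∉L  = trans (∑-δ-∉ L f e∉L) (sym (stable (e∉L ∘ cover)))

  enumeration-SumOver : {A : Pred U 0ℓ} (A-enum : Enumeration A) (f : U → Carrier) →
                        SumOver K A f (∑ (Enumeration.list A-enum) f)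
  enumeration-SumOver A-enum f = list , unique , sound , (λ _ Ae _ → complete Ae) , refl
    where open Enumeration A-enum

  SumOver-unique : {A : Pred U 0ℓ} {f : U → Carrier} {s t : Carrier} →
                   SumOver K A f s → SumOver K A f t → s ≈ t
  SumOver-unique {f = f} {s} {t} (xs , uxs , Axs , covxs , ∑xs≈s) (ys , uys , Ays , covys , ∑ys≈t) = begin
    s                                         ≈⟨ ∑xs≈s ⟨
    ∑ xs f                                    ≈⟨ ∑-cong xs (λ x∈xs → ∑-δ ys f uys (covys _ (All.lookup Axs x∈xs))) ⟨
    ∑ xs (λ x → ∑ ys (λ y → δ x y * f y))     ≈⟨ ∑-swap xs ys (λ x y → δ x y * f y) ⟩
    ∑ ys (λ y → ∑ xs (λ x → δ x y * f y))     ≈⟨ ∑-cong ys (λ {y} _ → ∑-cong xs (λ {x} _ → δ-swap f x y)) ⟩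
    ∑ ys (λ y → ∑ xs (λ x → δ y x * f x))     ≈⟨ ∑-cong ys (λ y∈ys → ∑-δ xs f uxs (covxs _ (All.lookup Ays y∈ys))) ⟩
    ∑ ys f                                    ≈⟨ ∑ys≈t ⟩
    t                                         ∎

  module _ {ℓ} {A : Pred U 0ℓ} {S : Pred (KVec K U) ℓ} where

    span-zero : InSpanOn K A S (λ _ → 0#)
    span-zero = [] , [] , λ _ _ → refl

    span-gen : ∀ {s} → S s → InSpanOn K A S s
    span-gen {s} Ss = (1# , s) ∷ [] , Ss ∷ [] , λ y _ → sym (trans (+-identityʳ _) (*-identityˡ (s y)))

    span-resp : ∀ {u w} → (∀ {y} → A y → u y ≈ w y) → InSpanOn K A S u → InSpanOn K A S w
    span-resp u≈w (xs , Sxs , u≈) = xs , Sxs , λ y Ay → trans (sym (u≈w Ay)) (u≈ y Ay)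

    span-+ : ∀ {u w} → InSpanOn K A S u → InSpanOn K A S w → InSpanOn K A S (λ y → u y + w y)
    span-+ (xs , Sxs , u≈) (ys , Sys , w≈) =
      xs ++ ys , ++⁺ Sxs Sys , λ y Ay → trans (+-cong (u≈ y Ay) (w≈ y Ay)) (sym (lincomb-++ xs ys y))
      where
        lincomb-++ : ∀ xs ys y → lincomb K (xs ++ ys) y ≈ lincomb K xs y + lincomb K ys y
        lincomb-++ []             ys y = sym (+-identityˡ _)
        lincomb-++ ((c , s) ∷ xs) ys y = trans (+-congˡ (lincomb-++ xs ys y)) (sym (+-assoc _ _ _))

    span-* : ∀ c {u} → InSpanOn K A S u → InSpanOn K A S (λ y → c * u y)
    span-* c (xs , Sxs , u≈) = map scale xs , scaled Sxs , λ y Ay → trans (*-congˡ (u≈ y Ay)) (sym (lincomb-* xs y))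
      where
        scale : Carrier × KVec K U → Carrier × KVec K U
        scale (a , s) = c * a , s
        scaled : ∀ {xs} → All (S ∘ proj₂) xs → All (S ∘ proj₂) (map scale xs)
        scaled []         = []
        scaled (Ss ∷ Sxs) = Ss ∷ scaled Sxs
        lincomb-* : ∀ xs y → lincomb K (map scale xs) y ≈ c * lincomb K xs y
        lincomb-* []             y = sym (zeroʳ c)
        lincomb-* ((a , s) ∷ xs) y = trans (+-cong (*-assoc c a (s y)) (lincomb-* xs y)) (sym (distribˡ c _ _))

  span-bind : ∀ {ℓ ℓ′} {U′ : Set} {A : Pred U 0ℓ} {B : Pred U′ 0ℓ}
              {S : Pred (KVec K U) ℓ} {T : Pred (KVec K U′) ℓ′} (f : U′ → U) →
              (∀ {x} → B x → A (f x)) → (∀ {s} → S s → InSpanOn K B T (s ∘ f)) →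
              ∀ {u} → InSpanOn K A S u → InSpanOn K B T (u ∘ f)
  span-bind {B = B} {S} {T} f B⇒A S⇒T (xs , Sxs , u≈) =
    span-resp (λ {x} Bx → sym (u≈ (f x) (B⇒A Bx))) (combine xs Sxs)
    where
      combine : ∀ xs → All (S ∘ proj₂) xs → InSpanOn K B T (lincomb K xs ∘ f)
      combine []             []         = span-zero
      combine ((c , s) ∷ xs) (Ss ∷ Sxs) = span-+ (span-* c (S⇒T Ss)) (combine xs Sxs)

  lincomb-vanishes : ∀ {ℓ} {S : Pred (KVec K U) ℓ} {e} → (∀ {s} → S s → s e ≈ 0#) →
                     ∀ {xs} → All (S ∘ proj₂) xs → lincomb K xs e ≈ 0#
  lincomb-vanishes S-e []                          = refl
  lincomb-vanishes S-e {(c , s) ∷ _} (Ss ∷ Sxs) =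
    trans (+-cong (trans (*-congˡ (S-e Ss)) (zeroʳ c)) (lincomb-vanishes S-e Sxs)) (+-identityʳ _)

  lincomb∈ : ∀ {ℓ} {G : Pred U 0ℓ} {V : Pred (KVec K U) ℓ} → IsSubspace K G V →
             ∀ xs → All (V ∘ proj₂) xs → V (lincomb K xs)
  lincomb∈ V-sub []             []         = IsSubspace.hasZero V-sub
  lincomb∈ V-sub ((c , s) ∷ xs) (Vs ∷ Vxs) =
    IsSubspace.add V-sub (IsSubspace.scale V-sub c Vs) (lincomb∈ V-sub xs Vxs)

  span-extend : {S : Pred (KVec K U) 0ℓ} {L : List U} {e : U} {u : KVec K U} →
                (∀ {s} → S s → s e ≈ 0#) → u e ≈ 0# →
                InSpanOn K (_∈ L) S u → InSpanOn K (_∈ e ∷ L) S u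
  span-extend S-e u-e (xs , Sxs , u≈) = xs , Sxs , λ
    { _ (here ≡.refl) → trans u-e (sym (lincomb-vanishes S-e Sxs))
    ; y (there y∈L)   → u≈ y y∈L }

  Perp : Pred U 0ℓ → List U → Pred (KVec K U) 0ℓ → Pred (KVec K U) 0ℓ
  Perp G L S v = supp K v ⊆ G × (∀ {s} → S s → dot L v s ≈ 0#)

  supp-+ : ∀ {x y} → ¬ (x + y ≈ 0#) → ¬ (x ≈ 0#) ⊎ ¬ (y ≈ 0#)
  supp-+ {x} {y} x+y≉0 with dec (x ≈ 0#)
  ... | yes x≈0 = inj₂ λ y≈0 → x+y≉0 (trans (+-cong x≈0 y≈0) (+-identityˡ 0#))
  ... | no x≉0  = inj₁ x≉0

  Perp-isSubspace : (G : Pred U 0ℓ) (L : List U) (S : Pred (KVec K U) 0ℓ) → IsSubspace K G (Perp G L S)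
  Perp-isSubspace G L S = record
    { supported = proj₁
    ; resp      = λ u≈v (u⊆G , u⊥S) →
                    (λ v≉0 → u⊆G (λ u≈0 → v≉0 (trans (sym (u≈v _)) u≈0))) ,
                    (λ Ss → trans (∑-cong L (λ {y} _ → *-congʳ (sym (u≈v y)))) (u⊥S Ss))
    ; hasZero   = (λ 0≉0 → ⊥-elim (0≉0 refl)) , (λ _ → ∑-zero L (λ _ → zeroˡ _))
    ; add       = λ (u⊆G , u⊥S) (v⊆G , v⊥S) →
                    [ u⊆G , v⊆G ]′ ∘ supp-+ ,
                    (λ {s} Ss → trans (∑-cong L (λ {y} _ → distribʳ (s y) _ _))
                      (trans (∑-+ L _ _) (trans (+-cong (u⊥S Ss) (v⊥S Ss)) (+-identityˡ 0#))))
    ; scale     = λ c (v⊆G , v⊥S) →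
                    (λ cv≉0 → v⊆G (λ v≈0 → cv≉0 (trans (*-congˡ v≈0) (zeroʳ c)))) ,
                    (λ {s} Ss → trans (∑-cong L (λ {y} _ → *-assoc c _ (s y)))
                      (trans (∑-* L c _) (trans (*-congˡ (v⊥S Ss)) (zeroʳ c))))
    }

  SpannedOrSeparated : List U → Pred (KVec K U) 0ℓ → KVec K U → Set
  SpannedOrSeparated L S u =
    InSpanOn K (_∈ L) S u ⊎ ∃[ v ] (Perp (_∈ L) L S v × ¬ (dot L v u ≈ 0#))

  private
    dot-∷-vanishing : (L : List U) {e : U} (v w : KVec K U) → v e ≈ 0# → dot (e ∷ L) v w ≈ dot L v w
    dot-∷-vanishing L v w v-e = trans (+-congʳ (trans (*-congʳ v-e) (zeroˡ _))) (+-identityˡ _)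

    vanishes-outside : ∀ {L : List U} {v e} → supp K v ⊆ (_∈ L) → e ∉ L → v e ≈ 0#
    vanishes-outside v⊆L e∉L = stable (e∉L ∘ v⊆L)

    extend-without-pivot : ∀ {L : List U} {e S u} → Unique (e ∷ L) → (∀ {s} → S s → s e ≈ 0#) →
                           SpannedOrSeparated L S u → SpannedOrSeparated (e ∷ L) S u
    extend-without-pivot {L = L} {e} {S} {u} uniq S-e (inj₁ u∈span) with dec (u e ≈ 0#)
    ... | yes u-e = inj₁ (span-extend S-e u-e u∈span)
    ... | no u-e≉0 =
      inj₂ (δ e , ((λ δ≉0 → here (≡.sym (δ-supp δ≉0))) , (λ Ss → trans (dot-δ _) (S-e Ss))) ,
            u-e≉0 ∘ trans (sym (dot-δ u)))
      where
        dot-δ : ∀ w → dot (e ∷ L) (δ e) w ≈ w e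
        dot-δ w = ∑-δ-∈ (e ∷ L) w uniq (here ≡.refl)
    extend-without-pivot {L = L} (e∉L ∷ _) S-e (inj₂ (v , (v⊆L , v⊥S) , v·u≉0)) =
      inj₂ (v , (there ∘ v⊆L , λ Ss → trans (restrict _) (v⊥S Ss)) , v·u≉0 ∘ trans (sym (restrict _)))
      where
        restrict : ∀ w → dot (_ ∷ L) v w ≈ dot L v w
        restrict w = dot-∷-vanishing L v w (vanishes-outside v⊆L (All¬⇒¬Any e∉L))

    module Pivot {U : Set} {L : List U} {e : U} (e∉L : e ∉ L) {S : Pred (KVec K U) 0ℓ}
                 {s₀ : KVec K U} (Ss₀ : S s₀) (s₀e≉0 : ¬ (s₀ e ≈ 0#)) where

      b : Carrier
      b = proj₁ (inverse (s₀ e) s₀e≉0)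

      reduce : KVec K U → KVec K U
      reduce s y = - (s e * b) * s₀ y + s y

      Reduced : Pred (KVec K U) 0ℓ
      Reduced t = ∃[ s ] (S s × t ≡ reduce s)

      reduce-pivot : ∀ s → reduce s e ≈ 0#
      reduce-pivot s = trans (+-congʳ (trans (regroup (s e) b (s₀ e)) (-‿cong s-e*1)))
                             (-‿inverseˡ (s e))
        where
          regroup : ∀ a c d → - (a * c) * d ≈ - (a * (d * c))
          regroup a c d = trans (sym (-‿distribˡ-* (a * c) d))
                                (-‿cong (trans (*-assoc a c d) (*-congˡ (*-comm c d))))
          s-e*1 : s e * (s₀ e * b) ≈ s e
          s-e*1 = trans (*-congˡ (proj₂ (inverse (s₀ e) s₀e≉0))) (*-identityʳ (s e))

      reduce-restore : ∀ s y → s y ≈ reduce s y + s e * b * s₀ y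
      reduce-restore s y = begin
        s y                                     ≈⟨ +-identityʳ (s y) ⟨
        s y + 0#                                ≈⟨ +-congˡ (-‿inverseˡ m) ⟨
        s y + (- m + m)                         ≈⟨ +-assoc (s y) (- m) m ⟨
        s y + - m + m                           ≈⟨ +-congʳ (+-comm (s y) (- m)) ⟩
        - m + s y + m                           ≈⟨ +-congʳ (+-congʳ (-‿distribˡ-* (s e * b) (s₀ y))) ⟩
        reduce s y + s e * b * s₀ y             ∎
        where
          m : Carrier
          m = s e * b * s₀ y

      reduced∈span : ∀ {A : Pred U 0ℓ} {t} → Reduced t → InSpanOn K A S t
      reduced∈span (s , Ss , ≡.refl) = span-+ (span-* _ (span-gen Ss₀)) (span-gen Ss)

      lift-span : ∀ {u} → InSpanOn K (_∈ L) Reduced (reduce u) → InSpanOn K (_∈ e ∷ L) S u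
      lift-span {u} ru∈span = span-resp (λ _ → sym (reduce-restore u _))
        (span-+ (span-bind id id reduced∈span
                  (span-extend (λ { (s , _ , ≡.refl) → reduce-pivot s }) (reduce-pivot u) ru∈span))
                (span-* (u e * b) (span-gen Ss₀)))

      lift-separation : ∀ {u v′} → Perp (_∈ L) L Reduced v′ → ¬ (dot L v′ (reduce u) ≈ 0#) →
                        ∃[ v ] (Perp (_∈ e ∷ L) (e ∷ L) S v × ¬ (dot (e ∷ L) v u ≈ 0#))
      lift-separation {u} {v′} (v′⊆L , v′⊥R) v′·ru≉0 =
        v , ([ there ∘ v′⊆L , here ∘ ≡.sym ∘ δ-supp ∘ factor-supp ]′ ∘ supp-+ ,
             λ {s} Ss → trans (key s) (v′⊥R (s , Ss , ≡.refl))) ,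
        v′·ru≉0 ∘ trans (sym (key u))
        where
          t : Carrier
          t = - (dot L v′ s₀ * b)
          v : KVec K U
          v y = v′ y + t * δ e y
          factor-supp : ∀ {y} → ¬ (t * δ e y ≈ 0#) → ¬ (δ e y ≈ 0#)
          factor-supp tδ≉0 δ≈0 = tδ≉0 (trans (*-congˡ δ≈0) (zeroʳ t))
          v-pivot : v e ≈ t
          v-pivot = trans (+-cong (vanishes-outside v′⊆L e∉L) (trans (*-congˡ (δ-refl e)) (*-identityʳ t)))
                          (+-identityˡ t)
          v-L : ∀ {y} → y ∈ L → v y ≈ v′ y
          v-L y∈L = trans (+-congˡ (trans (*-congˡ (δ-≢ λ { ≡.refl → e∉L y∈L })) (zeroʳ t))) (+-identityʳ _)
          key : ∀ w → dot (e ∷ L) v w ≈ dot L v′ (reduce w)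
          key w = begin
            v e * w e + dot L v w                      ≈⟨ +-cong (*-congʳ v-pivot) (∑-cong L (*-congʳ ∘ v-L)) ⟩
            t * w e + dot L v′ w                       ≈⟨ +-congʳ (swap (dot L v′ s₀) b (w e)) ⟩
            - (w e * b) * dot L v′ s₀ + dot L v′ w     ≈⟨ dot-linearʳ L v′ (- (w e * b)) s₀ w ⟨
            dot L v′ (reduce w)                        ∎
            where
              swap : ∀ d c x → - (d * c) * x ≈ - (x * c) * d
              swap d c x = trans (sym (-‿distribˡ-* (d * c) x))
                (trans (-‿cong (trans (*-comm (d * c) x) (trans (*-congˡ (*-comm d c)) (sym (*-assoc x c d)))))
                       (-‿distribˡ-* (x * c) d))

      extend-with-pivot : ∀ {u} → SpannedOrSeparated L Reduced (reduce u) → SpannedOrSeparated (e ∷ L) S u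
      extend-with-pivot (inj₁ ru∈span)                 = inj₁ (lift-span ru∈span)
      extend-with-pivot (inj₂ (v′ , v′⊥R , v′·ru≉0)) = inj₂ (lift-separation v′⊥R v′·ru≉0)

  span⊎separated : {L : List U} → Unique L → (S : Pred (KVec K U) 0ℓ) (u : KVec K U) →
                   SpannedOrSeparated L S u
  span⊎separated {L = []}    _ S u = inj₁ ([] , [] , λ _ ())
  span⊎separated {L = e ∷ L} uniq@(e∉L ∷ uniqL) S u with dec (∃[ s₀ ] (S s₀ × ¬ (s₀ e ≈ 0#)))
  ... | no no-pivot = extend-without-pivot uniq (λ Ss → stable (λ s-e≉0 → no-pivot (_ , Ss , s-e≉0)))
                        (span⊎separated uniqL S u)
  ... | yes (s₀ , Ss₀ , s₀e≉0) = extend-with-pivot (span⊎separated uniqL Reduced (reduce u))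
    where open Pivot (All¬⇒¬Any e∉L) {S = S} {s₀ = s₀} Ss₀ s₀e≉0

  module _ {G : Pred U 0ℓ} (G-enum : Enumeration G) where
    open Enumeration G-enum

    perp²⇒span : ∀ {S w} → Perp G list (Perp G list S) w → InSpanOn K G S w
    perp²⇒span {S} {w} (_ , w⊥V) with span⊎separated unique S w
    ... | inj₁ (xs , Sxs , w≈) = xs , Sxs , λ y Gy → w≈ y (complete Gy)
    ... | inj₂ (v , (v⊆L , v⊥S) , v·w≉0) =
      ⊥-elim (v·w≉0 (trans (dot-comm list v w) (w⊥V (All.lookup sound ∘ v⊆L , v⊥S))))

    perp-split : (S : Pred (KVec K U) 0ℓ) (P : Pred U 0ℓ) (e : U) → P ⊆ G → G e → ¬ P e →
                 (∃[ v ] (Perp G list S v × supp K v e × (∀ x → supp K v x → P x ⊎ x ≡ e)))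
                 ⊎ (∃[ w ] (Perp G list (Perp G list S) w × supp K w e
                             × (∀ x → supp K w x → (G x × ¬ P x) ⊎ x ≡ e)))
    perp-split S P e _ Ge ¬Pe = ⊎.map spanned separated (span⊎separated C.unique V (δ e))
      where
        V = Perp G list S
        module C = Enumeration (enumeration-∖ em G-enum P)
        e∈C : e ∈ C.list
        e∈C = C.complete (Ge , ¬Pe)
        spanned : InSpanOn K (_∈ C.list) V (δ e) →
                  ∃[ v ] (V v × supp K v e × (∀ x → supp K v x → P x ⊎ x ≡ e))
        spanned (xs , Vxs , δ≈) = lincomb K xs , Vv , v-e≉0 , cond
          where
            Vv : V (lincomb K xs)
            Vv = lincomb∈ (Perp-isSubspace G list S) xs Vxs
            v-e≉0 : supp K (lincomb K xs) e
            v-e≉0 v-e≈0 = 0≉1 (trans (sym v-e≈0) (trans (sym (δ≈ e e∈C)) (δ-refl e)))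
            cond : ∀ x → supp K (lincomb K xs) x → P x ⊎ x ≡ e
            cond x vx≉0 with dec (P x)
            ... | yes Px = inj₁ Px
            ... | no ¬Px = inj₂ (≡.sym (δ-supp λ δ≈0 →
                             vx≉0 (trans (sym (δ≈ x (C.complete (proj₁ Vv vx≉0 , ¬Px)))) δ≈0)))
        separated : ∃[ w ] (Perp (_∈ C.list) C.list V w × ¬ (dot C.list w (δ e) ≈ 0#)) →
                    ∃[ w ] (Perp G list V w × supp K w e × (∀ x → supp K w x → (G x × ¬ P x) ⊎ x ≡ e))
        separated (w , (w⊆C , w⊥V) , w·δ≉0) =
          w , (proj₁ ∘ C-sound ∘ w⊆C , λ Vv → trans (list≈C _) (w⊥V Vv)) ,
          (λ w-e≈0 → w·δ≉0 (trans (dot-comm C.list w (δ e)) (trans (∑-δ-∈ C.list w C.unique e∈C) w-e≈0))) ,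
          λ _ → inj₁ ∘ C-sound ∘ w⊆C
          where
            C-sound : ∀ {x} → x ∈ C.list → G x × ¬ P x
            C-sound = All.lookup C.sound
            list≈C : ∀ v → dot list w v ≈ dot C.list w v
            list≈C v = SumOver-unique (enumeration-SumOver G-enum _)
              (C.list , C.unique , All.map proj₁ C.sound ,
               (λ _ _ wv≉0 → w⊆C (λ w≈0 → wv≉0 (trans (*-congʳ w≈0) (zeroˡ _)))) , refl)

    perp-isPresentation : (S : Pred (KVec K U) 0ℓ) →
                          IsPresentation K G (Perp G list S) (Perp G list (Perp G list S))
    perp-isPresentation S = record
      { subV  = Perp-isSubspace G list S
      ; subW  = Perp-isSubspace G list (Perp G list S)
      ; orth  = λ v w Vv@(v⊆G , _) (_ , w⊥V) →
                  list , unique , All.tabulate (λ _ → tt) ,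
                  (λ _ _ vw≉0 → complete (v⊆G (λ v≈0 → vw≉0 (trans (*-congʳ v≈0) (zeroˡ _))))) ,
                  trans (dot-comm list v w) (w⊥V Vv)
      ; split = perp-split S
      }

module StarProfile (K : Field) (em : ExcludedMiddle (lsuc 0ℓ))
                   {E ι : Set} {F : ι → Pred E 0ℓ} (𝒮 : Star K F) where
  open Field K
  open Star 𝒮
  open Classical em
  open import Tactic.RingSolver.NonReflective (fromCommutativeRing commRing (λ _ → nothing))

  LeafVec : ι → Set
  LeafVec i = KVec K (E ⊎ Fin (m i))

  -- Outside the subtree of a pre-(co)vector set every node value to 0: the
  -- separator conditions then hold at every leaf and survive linear combinations,
  -- so every element of Π_∅ has a profile (σ = 1 for vectors, -1 for covectors).
  record Profile (σ : Carrier) (VC : Pred (KVec K E) 0ℓ) (VL : (i : ι) → Pred (LeafVec i) 0ℓ)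
                 (u : KVec K (StarU K 𝒮)) : Set where
    field
      centreVec : KVec K E
      leafVec   : (i : ι) → LeafVec i
      centre∈   : VC centreVec
      leaf∈     : ∀ i → VL i (leafVec i)
      glue      : ∀ i {e} → F i e → centreVec e ≈ σ * leafVec i (inj₁ e)
      atCentre  : ∀ {e} → ¬ (∃[ i ] F i e) → u (inj₁ e) ≈ centreVec e
      atLeaf    : ∀ i x → u (inj₂ (i , x)) ≈ leafVec i (inj₂ x)

  module _ {σ : Carrier} {G : Pred E 0ℓ} {VC : Pred (KVec K E) 0ℓ}
           {GL : (i : ι) → Pred (E ⊎ Fin (m i)) 0ℓ} {VL : (i : ι) → Pred (LeafVec i) 0ℓ}
           (VC-sub : IsSubspace K G VC) (VL-sub : ∀ i → IsSubspace K (GL i) (VL i)) where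

    profile-zero : Profile σ VC VL (λ _ → 0#)
    profile-zero = record
      { centreVec = λ _ → 0#
      ; leafVec   = λ _ _ → 0#
      ; centre∈   = IsSubspace.hasZero VC-sub
      ; leaf∈     = λ i → IsSubspace.hasZero (VL-sub i)
      ; glue      = λ _ _ → sym (zeroʳ σ)
      ; atCentre  = λ _ → refl
      ; atLeaf    = λ _ _ → refl
      }

    profile-combine : ∀ c {u u′} → Profile σ VC VL u → Profile σ VC VL u′ →
                      Profile σ VC VL (λ x → c * u x + u′ x)
    profile-combine c p p′ = record
      { centreVec = λ e → c * P.centreVec e + P′.centreVec e
      ; leafVec   = λ i y → c * P.leafVec i y + P′.leafVec i y
      ; centre∈   = IsSubspace.add VC-sub (IsSubspace.scale VC-sub c P.centre∈) P′.centre∈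
      ; leaf∈     = λ i → IsSubspace.add (VL-sub i) (IsSubspace.scale (VL-sub i) c (P.leaf∈ i)) (P′.leaf∈ i)
      ; glue      = λ i Fe → trans (+-cong (*-congˡ (P.glue i Fe)) (P′.glue i Fe))
                                   (solve 4 (λ c s a b → (c ⊗ (s ⊗ a) ⊕ s ⊗ b) ⊜ (s ⊗ (c ⊗ a ⊕ b))) refl c σ _ _)
      ; atCentre  = λ ¬F → +-cong (*-congˡ (P.atCentre ¬F)) (P′.atCentre ¬F)
      ; atLeaf    = λ i x → +-cong (*-congˡ (P.atLeaf i x)) (P′.atLeaf i x)
      }
      where
        module P  = Profile p
        module P′ = Profile p′

    profile-resp : ∀ {u u′} → (∀ x → u x ≈ u′ x) → Profile σ VC VL u → Profile σ VC VL u′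
    profile-resp u≈u′ p = record
      { centreVec = centreVec
      ; leafVec   = leafVec
      ; centre∈   = centre∈
      ; leaf∈     = leaf∈
      ; glue      = glue
      ; atCentre  = λ ¬F → trans (sym (u≈u′ _)) (atCentre ¬F)
      ; atLeaf    = λ i x → trans (sym (u≈u′ _)) (atLeaf i x)
      }
      where open Profile p

    private
      when : {A X : Set} → Dec A → (X → Carrier) → X → Carrier
      when (yes _) v = v
      when (no _)  _ = λ _ → 0#

      when∈ : {A X : Set} {H : Pred X 0ℓ} {P : Pred (X → Carrier) 0ℓ} {v : X → Carrier} →
              IsSubspace K H P → (d : Dec A) → (A → P v) → P (when d v)
      when∈ _     (yes a) Pv = Pv a
      when∈ P-sub (no _)  _  = IsSubspace.hasZero P-sub

    underlying⇒profile : ∀ {sgn u} → (∀ x → sgn x ≈ σ * x) →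
                         UnderlyingOf K 𝒮 sgn VC VL u → Profile σ VC VL u
    underlying⇒profile {sgn} {u} sgn≈σ* (S , vc , vl , _ , pre , und) = record
      { centreVec = when (dec (S centre)) vc
      ; leafVec   = λ i → when (dec (S (leaf i))) (vl i)
      ; centre∈   = when∈ VC-sub (dec (S centre)) (IsPre.nodeC pre)
      ; leaf∈     = λ i → when∈ (VL-sub i) (dec (S (leaf i))) (IsPre.nodeL pre i)
      ; glue      = λ i → glue (dec (S centre)) (dec (S (leaf i)))
      ; atCentre  = atCentre (dec (S centre))
      ; atLeaf    = λ i x → atLeaf (dec (S (leaf i)))
      }
      where
        glue : ∀ {i e} (c? : Dec (S centre)) (l? : Dec (S (leaf i))) → F i e →
               when c? vc e ≈ σ * when l? (vl i) (inj₁ e)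
        glue {i} {e} (yes c) (yes l) Fe = trans (IsPre.adjEq pre i c l e Fe) (sgn≈σ* _)
        glue {i} {e} (yes c) (no ¬l) Fe = trans (IsPre.outL pre i c ¬l e Fe) (sym (zeroʳ σ))
        glue {i} {e} (no ¬c) (yes l) Fe = sym (trans (*-congˡ (IsPre.outC pre i l ¬c e Fe)) (zeroʳ σ))
        glue         (no _)  (no _)  _  = sym (zeroʳ σ)
        atCentre : ∀ {e} (c? : Dec (S centre)) → ¬ (∃[ i ] F i e) → u (inj₁ e) ≈ when c? vc e
        atCentre (yes c) ¬F = Underlies.inC und _ ¬F c
        atCentre (no ¬c) ¬F = Underlies.outCu und _ ¬F ¬c
        atLeaf : ∀ {i x} (l? : Dec (S (leaf i))) → u (inj₂ (i , x)) ≈ when l? (vl i) (inj₂ x)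
        atLeaf (yes l) = Underlies.inLf und _ _ l
        atLeaf (no ¬l) = Underlies.outLf und _ _ ¬l

    span⇒profile : ∀ {sgn u} → (∀ x → sgn x ≈ σ * x) →
                   InSpan K (UnderlyingOf K 𝒮 sgn VC VL) u → Profile σ VC VL u
    span⇒profile {sgn} sgn≈σ* (xs , underlying , u≈) = profile-resp (λ x → sym (u≈ x tt)) (combine xs underlying)
      where
        combine : ∀ xs → All (UnderlyingOf K 𝒮 sgn VC VL ∘ proj₂) xs → Profile σ VC VL (lincomb K xs)
        combine []             []       = profile-zero
        combine ((c , s) ∷ xs) (s↓ ∷ ss↓) = profile-combine c (underlying⇒profile sgn≈σ* s↓) (combine xs ss↓)

module Construction (K : Field) (em : ExcludedMiddle (lsuc 0ℓ))
                    {E : Set} {V W : Pred (KVec K E) 0ℓ} (presVW : IsPresentation K (λ _ → ⊤) V W)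
                    {ι : Set} (F : ι → Pred E 0ℓ) (fin : ∀ i → Finite (F i))
                    (i₀ : ι) (w₀ : KVec K E) (WF : ι → Pred (KVec K E) 0ℓ) where
  open Field K
  open IsPresentation presVW using (subV; subW)
  open Classical em
  open LinearAlgebra K em
  open import Algebra.Properties.Ring ring using (-1*x≈-x; -0#≈0#; -‿distribˡ-*; -‿distribʳ-*; -‿involutive; +-inverseˡ-unique)

  F-enum : ∀ i → Enumeration (F i)
  F-enum i = finite⇒enumeration em (fin i)

  F-list : ι → List E
  F-list i = Enumeration.list (F-enum i)

  Leaf : Set
  Leaf = E ⊎ Fin 1

  ⋆ : Leaf
  ⋆ = inj₂ Data.Fin.zero

  LeafGround : ι → Pred Leaf 0ℓ
  LeafGround = LeafG K F (λ _ → 1)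

  leaf-enum : ∀ i → Enumeration (LeafGround i)
  leaf-enum i = record
    { list     = ⋆ ∷ map inj₁ F.list
    ; unique   = map⁺ (All.tabulate (λ _ ())) ∷ Unique.map⁺ inj₁-injective F.unique
    ; sound    = tt ∷ map⁺ F.sound
    ; complete = λ { {inj₁ e} Fe → there (∈-map⁺ inj₁ (F.complete Fe)) ; {inj₂ Data.Fin.zero} _ → here ≡.refl }
    }
    where
      module F = Enumeration (F-enum i)
      inj₁-injective : ∀ {x y : E} → _≡_ {A = Leaf} (inj₁ x) (inj₁ y) → x ≡ y
      inj₁-injective ≡.refl = ≡.refl

  leaf-list : ι → List Leaf
  leaf-list i = Enumeration.list (leaf-enum i)

  extend : KVec K E → Carrier → KVec K Leaf
  extend w c (inj₁ e) = w e
  extend w c (inj₂ _) = c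

  Gen : ι → Pred (KVec K Leaf) 0ℓ
  Gen i s = (i ≡ i₀ × s ≡ extend w₀ 1#)
          ⊎ (i ≢ i₀ × ((∃[ w ] (WF i w × s ≡ extend w 0#)) ⊎ s ≡ extend (λ _ → 0#) 1#))

  Vl Wl : (i : ι) → Pred (KVec K Leaf) 0ℓ
  Vl i = Perp (LeafGround i) (leaf-list i) (Gen i)
  Wl i = Perp (LeafGround i) (leaf-list i) (Vl i)

  𝒮 : Star K F
  𝒮 = record
    { m       = λ _ → 1
    ; Ffinite = fin
    ; Vl      = Vl
    ; Wl      = Wl
    ; pres    = λ i → perp-isPresentation (leaf-enum i) (Gen i)
    }

  x₀ : StarU K 𝒮
  x₀ = inj₂ (i₀ , Data.Fin.zero)

  dot-leaf : ∀ i (v w : KVec K Leaf) → dot (leaf-list i) v w ≡ v ⋆ * w ⋆ + dot (F-list i) (v ∘ inj₁) (w ∘ inj₁)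
  dot-leaf i v w = ≡.cong (v ⋆ * w ⋆ +_) (∑-map (F-list i) inj₁ (λ y → v y * w y))

  open StarProfile K em 𝒮

  leaf-pairing : ∀ {u} (p : Profile 1# V Vl u) → ∀ {i s} → Gen i s →
                 Profile.leafVec p i ⋆ * s ⋆ + dot (F-list i) (Profile.centreVec p) (s ∘ inj₁) ≈ 0#
  leaf-pairing p {i} {s} Gs = begin
    leafVec i ⋆ * s ⋆ + dot (F-list i) centreVec (s ∘ inj₁)               ≈⟨ +-congˡ (∑-cong (F-list i) glue₁) ⟨
    leafVec i ⋆ * s ⋆ + dot (F-list i) (leafVec i ∘ inj₁) (s ∘ inj₁)      ≡⟨ dot-leaf i (leafVec i) s ⟨
    dot (leaf-list i) (leafVec i) s                                        ≈⟨ proj₂ (leaf∈ i) Gs ⟩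
    0#                                                                     ∎
    where
      open Profile p
      open import Relation.Binary.Reasoning.Setoid setoid
      glue₁ : ∀ {e} → e ∈ F-list i → leafVec i (inj₁ e) * s (inj₁ e) ≈ centreVec e * s (inj₁ e)
      glue₁ e∈F = *-congʳ (sym (trans (glue i (All.lookup (Enumeration.sound (F-enum i)) e∈F)) (*-identityˡ _)))

  centre-of-vector : ∀ {u} → V∅ K 𝒮 V u →
    ∃[ v ] (V v × (∀ {e} → ¬ (∃[ i ] F i e) → u (inj₁ e) ≈ v e)
                × u x₀ ≈ - dot (F-list i₀) v w₀
                × (∀ {j} → j ≢ i₀ → ∀ {w} → WF j w → dot (F-list j) v w ≈ 0#))
  centre-of-vector u∈V∅ = centreVec , centre∈ , atCentre ,
    trans (atLeaf i₀ Data.Fin.zero)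
          (trans (sym (*-identityʳ _)) (+-inverseˡ-unique _ _ (leaf-pairing p (inj₁ (≡.refl , ≡.refl))))) ,
    λ {j} j≢i₀ WFw → trans (sym (trans (+-congʳ (zeroʳ _)) (+-identityˡ _)))
                           (leaf-pairing p (inj₂ (j≢i₀ , inj₁ (_ , WFw , ≡.refl))))
    where
      p = span⇒profile subV (λ i → Perp-isSubspace (LeafGround i) (leaf-list i) (Gen i))
                       (λ x → sym (*-identityˡ x)) u∈V∅
      open Profile p

  lincomb-Gen₀ : ∀ xs → All (Gen i₀ ∘ proj₂) xs → ∀ y → lincomb K xs y ≈ ∑ xs proj₁ * extend w₀ 1# y
  lincomb-Gen₀ []             []                               y = sym (zeroˡ _)
  lincomb-Gen₀ ((c , _) ∷ xs) (inj₁ (_ , ≡.refl) ∷ Gxs)       y =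
    trans (+-congˡ (lincomb-Gen₀ xs Gxs y)) (sym (distribʳ _ c _))
  lincomb-Gen₀ (_ ∷ _)        (inj₂ (i₀≢i₀ , _) ∷ _)          _ = ⊥-elim (i₀≢i₀ ≡.refl)

  span-Gen₀ : ∀ {t} → InSpanOn K (LeafGround i₀) (Gen i₀) t → ∀ {e} → F i₀ e → t (inj₁ e) ≈ t ⋆ * w₀ e
  span-Gen₀ {t} (xs , Gxs , t≈) {e} Fe = trans (trans (t≈ (inj₁ e) Fe) (lincomb-Gen₀ xs Gxs (inj₁ e)))
                                           (*-congʳ (sym t⋆≈c))
    where
      t⋆≈c : t ⋆ ≈ ∑ xs proj₁
      t⋆≈c = trans (t≈ ⋆ tt) (trans (lincomb-Gen₀ xs Gxs ⋆) (*-identityʳ _))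

  span-Gen : ∀ {j t} → j ≢ i₀ → InSpanOn K (LeafGround j) (Gen j) t → InSpanOn K (F j) (WF j) (t ∘ inj₁)
  span-Gen j≢i₀ = span-bind inj₁ id
    λ { (inj₁ (j≡i₀ , _))                    → ⊥-elim (j≢i₀ j≡i₀)
      ; (inj₂ (_ , inj₁ (_ , WFw , ≡.refl))) → span-gen WFw
      ; (inj₂ (_ , inj₂ ≡.refl))             → span-zero }

  centre-of-covector : ∀ {u} → W∅ K 𝒮 W u →
    ∃[ w ] (W w × (∀ {e} → ¬ (∃[ i ] F i e) → u (inj₁ e) ≈ w e)
                × (∀ {e} → F i₀ e → w e ≈ - (u x₀ * w₀ e))
                × (∀ {j} → j ≢ i₀ → InSpanOn K (F j) (WF j) w))
  centre-of-covector u∈W∅ = centreVec , centre∈ , atCentre ,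
    (λ Fe → trans (glue i₀ Fe) (trans (*-congˡ (trans (span-Gen₀ (leaf-span i₀) Fe)
                                                       (*-congʳ (sym (atLeaf i₀ Data.Fin.zero)))))
                                      (-1*x≈-x _))) ,
    λ {j} j≢i₀ → span-resp (λ Fe → sym (glue j Fe)) (span-* (- 1#) (span-Gen j≢i₀ (leaf-span j)))
    where
      p = span⇒profile subW (λ i → Perp-isSubspace (LeafGround i) (leaf-list i) (Vl i))
                       (λ x → sym (-1*x≈-x x)) u∈W∅
      open Profile p
      leaf-span : ∀ i → InSpanOn K (LeafGround i) (Gen i) (leafVec i)
      leaf-span i = perp²⇒span (leaf-enum i) (leaf∈ i)

  OutsideQ : Pred E 0ℓ → Pred (StarU K 𝒮) 0ℓ
  OutsideQ Q (inj₁ e) = StarG K 𝒮 (inj₁ e) × ¬ Q e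
  OutsideQ Q (inj₂ _) = ⊥

  OutsideQ⊆StarG : ∀ {Q} → OutsideQ Q ⊆ StarG K 𝒮
  OutsideQ⊆StarG {x = inj₁ _} = proj₁

  PairsNonzero : Pred E 0ℓ → KVec K E → KVec K E → Set
  PairsNonzero A v w = ∃[ s ] (SumOver K A (λ e → v e * w e) s × ¬ (s ≈ 0#))

  module _ {Q : Pred E 0ℓ} (Q∩𝓕=∅ : ∀ i e → Q e → ¬ F i e) where

    counterexample :
      ∀ {u} → V∅ K 𝒮 V u → supp K u x₀ → (∀ x → supp K u x → OutsideQ Q x ⊎ x ≡ x₀) →
      ∃[ v ] (V v × PairsNonzero (F i₀) v w₀ × (∀ e → Q e → v e ≈ 0#)
                  × (∀ {j} → j ≢ i₀ → ∀ {w} → WF j w → ¬ PairsNonzero (F j) v w))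
    counterexample u∈V∅ u-x₀≉0 u⊆ with centre-of-vector u∈V∅
    ... | v , Vv , u≈v , u-x₀≈ , v⊥WF =
      v , Vv , (_ , enumeration-SumOver (F-enum i₀) _ , v·w₀≉0) , v-Q ,
      λ j≢i₀ WFw (_ , v·w≈s , s≉0) →
        s≉0 (trans (SumOver-unique v·w≈s (enumeration-SumOver (F-enum _) _)) (v⊥WF j≢i₀ WFw))
      where
        v·w₀≉0 : ¬ (dot (F-list i₀) v w₀ ≈ 0#)
        v·w₀≉0 v·w₀≈0 = u-x₀≉0 (trans u-x₀≈ (trans (-‿cong v·w₀≈0) -0#≈0#))
        v-Q : ∀ e → Q e → v e ≈ 0#
        v-Q e Qe = trans (sym (u≈v λ (i , Fie) → Q∩𝓕=∅ i e Qe Fie)) (stable λ u-e≉0 →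
          [ (λ (_ , ¬Qe) → ¬Qe Qe) , (λ ()) ]′ (u⊆ (inj₁ e) u-e≉0))

  covector-solution : ∀ {Q} →
    ∀ {u} → W∅ K 𝒮 W u → supp K u x₀ → (∀ x → supp K u x → (StarG K 𝒮 x × ¬ OutsideQ Q x) ⊎ x ≡ x₀) →
    ∃[ w ] (W w
      × (∀ e → F i₀ e → w e ≈ w₀ e)
      × (∀ e → supp K w e → Q e ⊎ ∃[ j ] F j e)
      × (∀ j → j ≢ i₀ → InSpanOn K (F j) (WF j) w))
  covector-solution {Q} {u} u∈W∅ u-x₀≉0 u⊆ with centre-of-covector u∈W∅
  ... | c , Wc , u≈c , c-F₀ , c-span =
    (λ e → - b * c e) , IsSubspace.scale subW (- b) Wc ,
    (λ e Fe → trans (*-congˡ (c-F₀ Fe)) (normalise (w₀ e))) ,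
    supported , λ j j≢i₀ → span-* (- b) (c-span j≢i₀)
    where
      open import Relation.Binary.Reasoning.Setoid setoid
      t = u x₀
      b = proj₁ (inverse t u-x₀≉0)
      normalise : ∀ x → - b * - (t * x) ≈ x
      normalise x = begin
        - b * - (t * x)     ≈⟨ -‿distribʳ-* (- b) (t * x) ⟨
        - (- b * (t * x))   ≈⟨ -‿cong (-‿distribˡ-* b (t * x)) ⟨
        - - (b * (t * x))   ≈⟨ -‿involutive _ ⟩
        b * (t * x)         ≈⟨ *-assoc b t x ⟨
        b * t * x           ≈⟨ *-congʳ (trans (*-comm b t) (proj₂ (inverse t u-x₀≉0))) ⟩
        1# * x              ≈⟨ *-identityˡ x ⟩
        x                   ∎
      supported : ∀ e → supp K (λ e → - b * c e) e → Q e ⊎ ∃[ j ] F j e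
      supported e bc≉0 with dec (∃[ j ] F j e) | dec (Q e)
      ... | yes F∋e | _     = inj₂ F∋e
      ... | no _    | yes Qe = inj₁ Qe
      ... | no ¬F   | no ¬Qe = ⊥-elim (bc≉0 (trans (*-congˡ c-e≈0) (zeroʳ _)))
        where
          c-e≈0 : c e ≈ 0#
          c-e≈0 = trans (sym (u≈c ¬F)) (stable λ u-e≉0 →
            [ (λ (_ , ¬outside) → ¬outside (¬F , ¬Qe)) , (λ ()) ]′ (u⊆ (inj₁ e) u-e≉0))

lemma6p10 : (K : Field) → ExcludedMiddle (lsuc 0ℓ) →
    let open Field K in
    {E : Set} (V W : Pred (KVec K E) 0ℓ) → IsPresentation K (λ _ → ⊤) V W →
    {ι : Set} (F : ι → Pred E 0ℓ) →
    (∀ i j e → F i e → F j e → i ≡ j) →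
    (∀ i j → F i ⊆ F j → F j ⊆ F i → i ≡ j) →
    (∀ i → Finite (F i)) →
    Stellar K V W F →
    (i₀ : ι) (w₀ : KVec K E) (Q : Pred E 0ℓ) →
    (∀ i e → Q e → ¬ F i e) →
    (WF : ι → Pred (KVec K E) 0ℓ) →
    (∀ v → V v →
      (∃[ s ] (SumOver K (F i₀) (λ e → v e * w₀ e) s × ¬ (s ≈ 0#))) →
      (∀ e → Q e → v e ≈ 0#) →
      ∃[ j ] (j ≢ i₀ × ∃[ w ] (WF j w ×
        ∃[ s ] (SumOver K (F j) (λ e → v e * w e) s × ¬ (s ≈ 0#))))) →
    ∃[ w ] (W w
      × (∀ e → F i₀ e → w e ≈ w₀ e)
      × (∀ e → supp K w e → Q e ⊎ ∃[ j ] F j e)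
      × (∀ j → j ≢ i₀ → InSpanOn K (F j) (WF j) w))
lemma6p10 K em V W presVW F _ _ fin stellar i₀ w₀ Q Q∩𝓕=∅ WF hyp =
  [ (λ (_ , v∈V∅ , v-x₀≉0 , v⊆) →
      let v , Vv , v·w₀≉0 , v-Q , v⊥WF = counterexample Q∩𝓕=∅ v∈V∅ v-x₀≉0 v⊆
          j , j≢i₀ , w , WFw , v·w≉0   = hyp v Vv v·w₀≉0 v-Q
      in  ⊥-elim (v⊥WF j≢i₀ WFw v·w≉0))
  , (λ (_ , w∈W∅ , w-x₀≉0 , w⊆) → covector-solution w∈W∅ w-x₀≉0 w⊆)
  ]′ (IsPresentation.split (proj₁ (stellar 𝒮)) (OutsideQ Q) x₀ OutsideQ⊆StarG tt λ ())
  where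
    open Construction K em presVW F fin i₀ w₀ WF
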